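{- $\chi_{CF}(\mathsf{I}^2_n)=\Theta(\sqrt{n})$ as $n\to\infty$.
   Context: A conflict-free coloring (CF-coloring) of a hypergraph $(V,\mathcal{E})$ is a map $\varphi$ on $V$ such that every nonempty hyperedge $e$ contains a vertex $x$ with $\varphi(y)\ne\varphi(x)$ for all $y\in e\setminus\{x\}$; $\chi_{CF}(H)$ is the least number of colors in a CF-coloring of $H$. A (discrete) interval in $[n]$ is a subset of $[n]$ consisting of consecutive integers. The 2-interval hypergraph $\mathsf{I}^2_n$ has vertex set $[n]$ and hyperedges all sets $I_1\cup I_2$ where $I_1,I_2\subseteq[n]$ are intervals and $|I_1\cup I_2|\ge 3$. -}

module Defs where

open import Data.Nat using (ℕ; zero; suc; _+_; _*_; _≤_; _<_; _≤ᵇ_)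
open import Data.Bool using (Bool; true; false; _∧_; _∨_; T)
open import Data.List using (List; []; _∷_; map; upTo; length; filterᵇ)
open import Data.Product using (Σ; _×_; ∃)
open import Relation.Binary.PropositionalEquality using (_≡_)
open import Relation.Nullary using (¬_)

vertices : ℕ → List ℕ
vertices n = map suc (upTo n)

inInterval : ℕ → ℕ → ℕ → Bool
inInterval a b x = (a ≤ᵇ x) ∧ (x ≤ᵇ b)

-- An interval of [n] is given by endpoints a, b with 1 ≤ a and b ≤ n
-- (a > b gives the empty interval).
IsIntervalIn : ℕ → ℕ → ℕ → Set
IsIntervalIn n a b = (1 ≤ a) × (b ≤ n)

record TwoInterval : Set where
  constructor twoI
  field
    a₁ b₁ a₂ b₂ : ℕ

open TwoInterval public

inUnion : TwoInterval → ℕ → Bool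
inUnion e x = inInterval (a₁ e) (b₁ e) x ∨ inInterval (a₂ e) (b₂ e) x

card : ℕ → TwoInterval → ℕ
card n e = length (filterᵇ (inUnion e) (vertices n))

IsHyperedge : ℕ → TwoInterval → Set
IsHyperedge n e =
  IsIntervalIn n (a₁ e) (b₁ e) × IsIntervalIn n (a₂ e) (b₂ e) × (3 ≤ card n e)

IsColoring : ℕ → ℕ → (ℕ → ℕ) → Set
IsColoring n k φ = ∀ x → 1 ≤ x → x ≤ n → φ x < k

ConflictFreeOn : (ℕ → ℕ) → TwoInterval → Set
ConflictFreeOn φ e =
  ∃ λ x → T (inUnion e x) ×
    (∀ y → T (inUnion e y) → ¬ (y ≡ x) → ¬ (φ y ≡ φ x))

HasCFColoring : ℕ → ℕ → Set
HasCFColoring n k =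
  Σ (ℕ → ℕ) λ φ → IsColoring n k φ ×
    (∀ e → IsHyperedge n e → ConflictFreeOn φ e)

IsChiCF : ℕ → ℕ → Set
IsChiCF n k = HasCFColoring n k × (∀ j → HasCFColoring n j → k ≤ j)

module Submission where

-- Lower bound: of the k² + 1 disjoint pairs {2i + 1, 2i + 2} two carry the same ordered pair of
-- colors under any k-coloring, and together they form a hyperedge without a uniquely colored
-- vertex; hence n ≤ 2k² + 1.
--
-- Upper bound: for n ≤ s² cut [1, s²] into s blocks of s consecutive vertices. The first vertex
-- of block g gets color g, a vertex at odd offset o gets s + o and one at even offset o > 0 gets
-- 2s + 4g + o, so 7s colors are used. In a hyperedge without a uniquely colored vertex no vertex
-- is a block start, so each of its two intervals lies inside one block; colors within a block are
-- distinct, so the intervals lie in blocks g < h and every vertex is twinned across. Odd offsets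
-- then match exactly while even offsets are shifted by 4(h − g) ≥ 4, which two intervals, one of
-- them with two vertices, cannot accommodate. Taking s = ⌈√n⌉ gives χ_CF(I²ₙ) ≤ 7⌈√n⌉.

open import Defs
open import Data.Nat using (ℕ; zero; suc; _+_; _*_; _≤_; _<_; _≥_; _≰_; z≤n; s≤s; pred; _/_; _%_; NonZero; >-nonZero⁻¹; parity; _≟_; _≤?_; _<?_; _⊓_)
open import Data.Nat.Properties
open import Data.Nat.DivMod using (m≡m%n+[m/n]*n; m%n<n; [m+kn]%n≡m%n; m<n⇒m%n≡m; +-distrib-/-∣ʳ; m<n⇒m/n≡0; m*n/n≡m; /-monoˡ-≤; m<n*o⇒m/o<n)
open import Data.Nat.Divisibility using (n∣m*n)
open import Data.Nat.Induction using (<-wellFounded)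
open import Data.Nat.Tactic.RingSolver using (solve)
open import Data.Parity.Base using (Parity; 0ℙ; 1ℙ; _⁻¹)
open import Data.Parity.Properties using (suc-homo-⁻¹; ⁻¹-selfInverse)
open import Data.Bool using (Bool; true; false; _∨_; T; if_then_else_)
open import Data.Bool.Properties using (T-∧; T-∨)
open import Data.Empty using (⊥; ⊥-elim)
open import Data.Fin using (Fin; toℕ; fromℕ<; combine; finToFun; funToFin)
open import Data.Fin.Properties using (toℕ<n; toℕ-fromℕ<; fromℕ<-injective; any?; finToFun-funToFin; pigeonhole; combine-injective)
open import Data.List using ([]; _∷_; _∷ʳ_; _++_; map; upTo; length; filterᵇ)
open import Data.List.Properties using (map-++; filter-++; length-++; upTo-∷ʳ)
open import Data.Product using (Σ; ∃; ∃₂; _×_; _,_; proj₁; proj₂; uncurry)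
open import Data.Sum using (_⊎_; inj₁; inj₂; swap; [_,_])
import Data.Sum as Sum
open import Function using (_∘_; _∘′_)
open import Function.Bundles using (Equivalence)
open import Induction.WellFounded using (Acc; acc)
open import Relation.Binary.Definitions using (tri<; tri≈; tri>)
open import Relation.Binary.PropositionalEquality hiding ([_])
open import Relation.Nullary using (¬_; Dec; yes; no; T?; ¬?; map′; _×-dec_; _→-dec_; contradiction; decidable-stable)
open import Relation.Unary using (Pred; Decidable)

module _ {p} {P : Pred ℕ p} (P? : Decidable P) where

  least-satisfying : ∀ m → P m → Σ ℕ λ k → P k × (∀ j → P j → k ≤ j)
  least-satisfying m = go m (<-wellFounded m)
    where
    go : ∀ m → Acc _<_ m → P m → Σ ℕ λ k → P k × (∀ j → P j → k ≤ j)
    go m (acc below) pm with anyUpTo? P? m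
    ... | yes (j , j<m , pj) = go j (below j<m) pj
    ... | no none = m , pm , λ j pj → ≮⇒≥ (λ j<m → none (j , j<m , pj))

inInterval⁻ : ∀ {a b x} → T (inInterval a b x) → a ≤ x × x ≤ b
inInterval⁻ t = let (p , q) = Equivalence.to T-∧ t in ≤ᵇ⇒≤ _ _ p , ≤ᵇ⇒≤ _ _ q

inInterval⁺ : ∀ {a b x} → a ≤ x → x ≤ b → T (inInterval a b x)
inInterval⁺ p q = Equivalence.from T-∧ (≤⇒≤ᵇ p , ≤⇒≤ᵇ q)

inUnion⁻ : ∀ e {x} → T (inUnion e x) → (a₁ e ≤ x × x ≤ b₁ e) ⊎ (a₂ e ≤ x × x ≤ b₂ e)
inUnion⁻ e t with Equivalence.to T-∨ t
... | inj₁ p = inj₁ (inInterval⁻ p)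
... | inj₂ p = inj₂ (inInterval⁻ p)

inUnion⁺ˡ : ∀ e {x} → a₁ e ≤ x → x ≤ b₁ e → T (inUnion e x)
inUnion⁺ˡ e p q = Equivalence.from T-∨ (inj₁ (inInterval⁺ p q))

inUnion⁺ʳ : ∀ e {x} → a₂ e ≤ x → x ≤ b₂ e → T (inUnion e x)
inUnion⁺ʳ e p q = Equivalence.from T-∨ (inj₂ (inInterval⁺ p q))

hyperedge⊆[1,n] : ∀ {n} e → IsHyperedge n e → ∀ {x} → T (inUnion e x) → 1 ≤ x × x ≤ n
hyperedge⊆[1,n] e ((1≤a₁ , b₁≤n) , (1≤a₂ , b₂≤n) , _) t with inUnion⁻ e t
... | inj₁ (a₁≤x , x≤b₁) = ≤-trans 1≤a₁ a₁≤x , ≤-trans x≤b₁ b₁≤n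
... | inj₂ (a₂≤x , x≤b₂) = ≤-trans 1≤a₂ a₂≤x , ≤-trans x≤b₂ b₂≤n

-- Counting members of a hyperedge

count : (ℕ → Bool) → ℕ → ℕ
count P n = length (filterᵇ P (vertices n))

count-suc : ∀ P n → count P (suc n) ≡ count P n + (if P (suc n) then 1 else 0)
count-suc P n = begin
  length (filterᵇ P (map suc (upTo (suc n))))
    ≡⟨ cong (λ xs → length (filterᵇ P (map suc xs))) (upTo-∷ʳ n) ⟨
  length (filterᵇ P (map suc (upTo n ∷ʳ n)))
    ≡⟨ cong (length ∘′ filterᵇ P) (map-++ suc (upTo n) (n ∷ [])) ⟩
  length (filterᵇ P (vertices n ∷ʳ suc n))
    ≡⟨ cong length (filter-++ (λ x → T? (P x)) (vertices n) (suc n ∷ [])) ⟩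
  length (filterᵇ P (vertices n) ++ filterᵇ P (suc n ∷ []))
    ≡⟨ length-++ (filterᵇ P (vertices n)) ⟩
  count P n + length (filterᵇ P (suc n ∷ []))
    ≡⟨ cong (count P n +_) (singleton (P (suc n)) refl) ⟩
  count P n + (if P (suc n) then 1 else 0)
    ∎
  where
  open ≡-Reasoning
  singleton : ∀ b → P (suc n) ≡ b → length (filterᵇ P (suc n ∷ [])) ≡ (if b then 1 else 0)
  singleton true eq rewrite eq = refl
  singleton false eq rewrite eq = refl

count-step : ∀ P n → count P n ≤ count P (suc n)
count-step P n = ≤-trans (m≤m+n (count P n) _) (≤-reflexive (sym (count-suc P n)))

count-mono : ∀ P {m n} → m ≤ n → count P m ≤ count P n
count-mono P {n = zero} z≤n = ≤-refl
count-mono P {m} {suc n} m≤1+n with m≤n⇒m<n∨m≡n m≤1+n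
... | inj₁ (s≤s m≤n) = ≤-trans (count-mono P m≤n) (count-step P n)
... | inj₂ refl = ≤-refl

count-member : ∀ P n → T (P (suc n)) → count P (suc n) ≡ suc (count P n)
count-member P n t with P (suc n) | count-suc P n
... | true | eq = trans eq (+-comm (count P n) 1)

three-members⇒3≤count : ∀ P {n x y z} → 1 ≤ x → x < y → y < z → z ≤ n →
  T (P x) → T (P y) → T (P z) → 3 ≤ count P n
three-members⇒3≤count P {n} {suc x} {suc y} {suc z} _ (s≤s x<y) (s≤s y<z) 1+z≤n px py pz = begin
  3                          ≤⟨ s≤s (s≤s (s≤s z≤n)) ⟩
  3 + count P x              ≡⟨ cong (2 +_) (count-member P x px) ⟨
  2 + count P (suc x)        ≤⟨ +-monoʳ-≤ 2 (count-mono P x<y) ⟩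
  2 + count P y              ≡⟨ cong suc (count-member P y py) ⟨
  1 + count P (suc y)        ≤⟨ +-monoʳ-≤ 1 (count-mono P y<z) ⟩
  1 + count P z              ≡⟨ count-member P z pz ⟨
  count P (suc z)            ≤⟨ count-mono P 1+z≤n ⟩
  count P n                  ∎
  where open ≤-Reasoning

count-witness : ∀ P {m} n → suc m ≤ count P n → ∃ λ x → x < n × T (P (suc x)) × m ≤ count P x
count-witness P zero ()
count-witness P {m} (suc n) h with P (suc n) in eq | subst (suc m ≤_) (count-suc P n) h
... | true  | h′ = n , ≤-refl , subst T (sym eq) _ , ≤-pred (subst (suc m ≤_) (+-comm (count P n) 1) h′)
... | false | h′ with count-witness P n (subst (suc m ≤_) (+-identityʳ (count P n)) h′)
...   | x , x<n , px , m≤count = x , m<n⇒m<1+n x<n , px , m≤count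

3≤count⇒three-members : ∀ P n → 3 ≤ count P n →
  ∃ λ x → ∃ λ y → ∃ λ z → x < y × y < z × T (P x) × T (P y) × T (P z)
3≤count⇒three-members P n h with count-witness P n h
... | z , _ , pz , h₂ with count-witness P z h₂
...   | y , y<z , py , h₁ with count-witness P y h₁
...     | x , x<y , px , _ = suc x , suc y , suc z , s≤s x<y , s≤s y<z , px , py , pz

-- Existence of χ_CF

ConflictFree : ℕ → (ℕ → ℕ) → Set
ConflictFree n φ = ∀ e → IsHyperedge n e → ConflictFreeOn φ e

NoUniqueColor : (ℕ → ℕ) → TwoInterval → Set
NoUniqueColor φ e = ∀ {x} → T (inUnion e x) → ∃ λ y → T (inUnion e y) × y ≢ x × φ y ≡ φ x

noUniqueColor⇒¬conflictFreeOn : ∀ {φ e} → NoUniqueColor φ e → ¬ ConflictFreeOn φ e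
noUniqueColor⇒¬conflictFreeOn twin (x , x∈e , unique) with twin x∈e
... | y , y∈e , y≢x , φy≡φx = unique y y∈e y≢x φy≡φx

conflictFreeOn? : ∀ n φ e → (∀ {x} → T (inUnion e x) → x ≤ n) → Dec (ConflictFreeOn φ e)
conflictFreeOn? n φ e bounded = map′
  (λ (x , _ , x∈e , unique) → x , x∈e , λ y y∈e → unique {y} (s≤s (bounded y∈e)) y∈e)
  (λ (x , x∈e , unique) → x , s≤s (bounded x∈e) , x∈e , λ {y} _ y∈e → unique y y∈e)
  (anyUpTo? (λ x → T? (inUnion e x) ×-dec
     allUpTo? (λ y → T? (inUnion e y) →-dec ¬? (y ≟ x) →-dec ¬? (φ y ≟ φ x)) (suc n)) (suc n))

¬conflictFreeOn⇒noUniqueColor : ∀ n φ e → (∀ {x} → T (inUnion e x) → x ≤ n) →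
  ¬ ConflictFreeOn φ e → NoUniqueColor φ e
¬conflictFreeOn⇒noUniqueColor n φ e bounded ¬cf {x} x∈e
  with anyUpTo? (λ y → T? (inUnion e y) ×-dec ¬? (y ≟ x) ×-dec φ y ≟ φ x) (suc n)
... | yes (y , _ , twin) = y , twin
... | no none = contradiction (x , x∈e , λ y y∈e y≢x φy≡φx → none (y , s≤s (bounded y∈e) , y∈e , y≢x , φy≡φx)) ¬cf

hyperedge? : ∀ n e → Dec (IsHyperedge n e)
hyperedge? n e = (1 ≤? a₁ e ×-dec b₁ e ≤? n) ×-dec (1 ≤? a₂ e ×-dec b₂ e ≤? n) ×-dec 3 ≤? card n e

conflictFreeIfHyperedge? : ∀ n φ e → Dec (IsHyperedge n e → ConflictFreeOn φ e)
conflictFreeIfHyperedge? n φ e with hyperedge? n e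
... | no ¬he = yes (λ he → contradiction he ¬he)
... | yes he with conflictFreeOn? n φ e (proj₂ ∘ hyperedge⊆[1,n] e he)
...   | yes cf = yes (λ _ → cf)
...   | no ¬cf = no (λ cf → ¬cf (cf he))

SameMembers : TwoInterval → TwoInterval → Set
SameMembers e e′ = ∀ x → inUnion e x ≡ inUnion e′ x

T-extensional : ∀ {p q} → (T p → T q) → (T q → T p) → p ≡ q
T-extensional {true}  {true}  _ _ = refl
T-extensional {true}  {false} f _ = ⊥-elim (f _)
T-extensional {false} {true}  _ g = ⊥-elim (g _)
T-extensional {false} {false} _ _ = refl

filterᵇ-cong : ∀ {P Q : ℕ → Bool} → (∀ x → P x ≡ Q x) → ∀ xs → filterᵇ P xs ≡ filterᵇ Q xs
filterᵇ-cong eq [] = refl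
filterᵇ-cong {P} {Q} eq (x ∷ xs) with P x | Q x | eq x
... | true  | .true  | refl = cong (x ∷_) (filterᵇ-cong eq xs)
... | false | .false | refl = filterᵇ-cong eq xs

conflictFreeOn-respects : ∀ φ e e′ → SameMembers e e′ → ConflictFreeOn φ e → ConflictFreeOn φ e′
conflictFreeOn-respects φ _ _ eq (x , x∈e , unique) =
  x , subst T (eq x) x∈e , λ y y∈e′ → unique y (subst T (sym (eq y)) y∈e′)

-- Replacing a left endpoint a by a ⊓ (n + 1) does not change an interval ending at most at n,
-- and leaves only finitely many hyperedges to inspect.
clamp : ℕ → TwoInterval → TwoInterval
clamp n (twoI a b c d) = twoI (a ⊓ suc n) b (c ⊓ suc n) d

inInterval-clamp : ∀ {n a b} x → b ≤ n → inInterval a b x ≡ inInterval (a ⊓ suc n) b x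
inInterval-clamp {n} {a} {b} x b≤n = T-extensional
  (λ t → let (a≤x , x≤b) = inInterval⁻ t in inInterval⁺ (≤-trans (m⊓n≤m a (suc n)) a≤x) x≤b)
  (λ t → let (a⊓≤x , x≤b) = inInterval⁻ t in inInterval⁺ (a≤x a⊓≤x (≤-trans x≤b b≤n)) x≤b)
  where
  a≤x : a ⊓ suc n ≤ x → x ≤ n → a ≤ x
  a≤x a⊓≤x x≤n with ⊓-sel a (suc n)
  ... | inj₁ eq = subst (_≤ x) eq a⊓≤x
  ... | inj₂ eq = contradiction (subst (_≤ x) eq a⊓≤x) (<⇒≱ (s≤s x≤n))

clamp-sameMembers : ∀ n e → b₁ e ≤ n → b₂ e ≤ n → SameMembers e (clamp n e)
clamp-sameMembers n (twoI a b c d) b≤n d≤n x = cong₂ _∨_ (inInterval-clamp {a = a} x b≤n) (inInterval-clamp {a = c} x d≤n)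

clamp-hyperedge : ∀ n e → IsHyperedge n e → IsHyperedge n (clamp n e)
clamp-hyperedge n (twoI a b c d) ((1≤a , b≤n) , (1≤c , d≤n) , 3≤card) =
  (⊓-glb 1≤a (s≤s z≤n) , b≤n) , (⊓-glb 1≤c (s≤s z≤n) , d≤n) ,
  subst (3 ≤_) (cong length (filterᵇ-cong (clamp-sameMembers n (twoI a b c d) b≤n d≤n) (vertices n))) 3≤card

conflictFree? : ∀ n φ → Dec (ConflictFree n φ)
conflictFree? n φ = map′ fromBounded toBounded
  (allUpTo? (λ a → allUpTo? (λ b → allUpTo? (λ c → allUpTo? (λ d →
     conflictFreeIfHyperedge? n φ (twoI a b c d)) (suc n)) (suc (suc n))) (suc n)) (suc (suc n)))
  where
  Bounded : Set
  Bounded = ∀ {a} → a < suc (suc n) → ∀ {b} → b < suc n → ∀ {c} → c < suc (suc n) → ∀ {d} → d < suc n →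
    IsHyperedge n (twoI a b c d) → ConflictFreeOn φ (twoI a b c d)
  toBounded : ConflictFree n φ → Bounded
  toBounded cf _ _ _ _ = cf _
  fromBounded : Bounded → ConflictFree n φ
  fromBounded cf e@(twoI a b c d) he@((_ , b≤n) , (_ , d≤n) , _) =
    conflictFreeOn-respects φ (clamp n e) e (sym ∘ clamp-sameMembers n e b≤n d≤n)
      (cf (s≤s (m⊓n≤n a (suc n))) (s≤s b≤n) (s≤s (m⊓n≤n c (suc n))) (s≤s d≤n) (clamp-hyperedge n e he))

conflictFree-agree : ∀ n φ ψ → (∀ {x} → 1 ≤ x → x ≤ n → φ x ≡ ψ x) → ConflictFree n φ → ConflictFree n ψ
conflictFree-agree n φ ψ agree cf e he with cf e he
... | x , x∈e , unique = x , x∈e , λ y y∈e y≢x ψy≡ψx →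
  let (1≤x , x≤n) = hyperedge⊆[1,n] e he x∈e
      (1≤y , y≤n) = hyperedge⊆[1,n] e he y∈e
  in unique y y∈e y≢x (trans (agree 1≤y y≤n) (trans ψy≡ψx (sym (agree 1≤x x≤n))))

-- Only the values on [1, n] matter, so colorings can be searched as tables Fin n → Fin k.
fromTable : ∀ {n k} → (Fin n → Fin k) → ℕ → ℕ
fromTable {n} f x with pred x <? n
... | yes x-1<n = toℕ (f (fromℕ< x-1<n))
... | no _ = 0

fromTable-isColoring : ∀ {n k} (f : Fin n → Fin k) → IsColoring n k (fromTable f)
fromTable-isColoring {n} f (suc x) _ x<n with x <? n
... | yes x<n′ = toℕ<n (f (fromℕ< x<n′))
... | no x≮n = contradiction x<n x≮n

fromTable-cong : ∀ {n k} {f g : Fin n → Fin k} → (∀ i → f i ≡ g i) → ∀ x → fromTable f x ≡ fromTable g x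
fromTable-cong {n} f≗g x with pred x <? n
... | yes x-1<n = cong toℕ (f≗g (fromℕ< x-1<n))
... | no _ = refl

toTable : ∀ {n k φ} → IsColoring n k φ → Fin n → Fin k
toTable col i = fromℕ< (col (suc (toℕ i)) (s≤s z≤n) (toℕ<n i))

fromTable-toTable : ∀ {n k φ} (col : IsColoring n k φ) → ∀ {x} → 1 ≤ x → x ≤ n → fromTable (toTable col) x ≡ φ x
fromTable-toTable {n} {φ = φ} col {suc x} _ x<n with x <? n
... | yes x<n′ = trans (toℕ-fromℕ< _) (cong (φ ∘ suc) (toℕ-fromℕ< x<n′))
... | no x≮n = contradiction x<n x≮n

∃-table? : ∀ {n k} (P : (Fin n → Fin k) → Set) → (∀ {f g} → (∀ i → f i ≡ g i) → P f → P g) →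
  (∀ f → Dec (P f)) → Dec (∃ P)
∃-table? P resp P? = map′
  (λ (i , p) → finToFun i , p)
  (λ (f , p) → funToFin f , resp (sym ∘ finToFun-funToFin f) p)
  (any? (P? ∘ finToFun))

hasCFColoring? : ∀ n k → Dec (HasCFColoring n k)
hasCFColoring? n k = map′
  (λ (f , cf) → fromTable f , fromTable-isColoring f , cf)
  (λ (φ , col , cf) → toTable col , conflictFree-agree n φ _ (λ 1≤x x≤n → sym (fromTable-toTable col 1≤x x≤n)) cf)
  (∃-table? (λ f → ConflictFree n (fromTable f))
    (λ f≗g → conflictFree-agree n _ _ (λ {x} _ _ → fromTable-cong f≗g x))
    (λ f → conflictFree? n (fromTable f)))

chiCF-exists : ∀ n k → HasCFColoring n k → ∃ (IsChiCF n)
chiCF-exists n = least-satisfying (hasCFColoring? n)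

-- Lower bound

a≤x≤1+a⇒x≡a∨x≡1+a : ∀ {a x} → a ≤ x → x ≤ suc a → x ≡ a ⊎ x ≡ suc a
a≤x≤1+a⇒x≡a∨x≡1+a a≤x x≤1+a with m≤n⇒m<n∨m≡n x≤1+a
... | inj₁ (s≤s x≤a) = inj₁ (≤-antisym x≤a a≤x)
... | inj₂ x≡1+a = inj₂ x≡1+a

repeatedPair-noUniqueColor : ∀ φ {p q} → suc p < q → φ p ≡ φ q → φ (suc p) ≡ φ (suc q) →
  NoUniqueColor φ (twoI p (suc p) q (suc q))
repeatedPair-noUniqueColor φ {p} {q} 1+p<q φp≡φq φ1+p≡φ1+q x∈e = twin (inUnion⁻ e x∈e)
  where
  e = twoI p (suc p) q (suc q)
  p<q : p < q
  p<q = <-trans (n<1+n p) 1+p<q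
  1+p<1+q : suc p < suc q
  1+p<1+q = m<n⇒m<1+n 1+p<q
  twin : ∀ {x} → (p ≤ x × x ≤ suc p) ⊎ (q ≤ x × x ≤ suc q) → ∃ λ y → T (inUnion e y) × y ≢ x × φ y ≡ φ x
  twin (inj₁ (p≤x , x≤1+p)) with a≤x≤1+a⇒x≡a∨x≡1+a p≤x x≤1+p
  ... | inj₁ refl = q , inUnion⁺ʳ e ≤-refl (n≤1+n q) , >⇒≢ p<q , sym φp≡φq
  ... | inj₂ refl = suc q , inUnion⁺ʳ e (n≤1+n q) ≤-refl , >⇒≢ 1+p<1+q , sym φ1+p≡φ1+q
  twin (inj₂ (q≤x , x≤1+q)) with a≤x≤1+a⇒x≡a∨x≡1+a q≤x x≤1+q
  ... | inj₁ refl = p , inUnion⁺ˡ e ≤-refl (n≤1+n p) , <⇒≢ p<q , φp≡φq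
  ... | inj₂ refl = suc p , inUnion⁺ˡ e (n≤1+n p) ≤-refl , <⇒≢ 1+p<1+q , φ1+p≡φ1+q

repeatedPair : ∀ {n k φ} → IsColoring n k φ → 2 * suc (k * k) ≤ n →
  ∃₂ λ p q → 1 ≤ p × suc p < q × suc q ≤ n × φ p ≡ φ q × φ (suc p) ≡ φ (suc q)
repeatedPair {n} {k} {φ} col 2[k²+1]≤n = collision (pigeonhole (n<1+n (k * k)) colorPair)
  where
  first : Fin (suc (k * k)) → ℕ
  first i = suc (2 * toℕ i)
  pair≤n : ∀ i → suc (first i) ≤ n
  pair≤n i = ≤-trans (≤-reflexive (sym (*-suc 2 (toℕ i)))) (≤-trans (*-monoʳ-≤ 2 (toℕ<n i)) 2[k²+1]≤n)
  colorPair : Fin (suc (k * k)) → Fin (k * k)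
  colorPair i = combine (fromℕ< (col (first i) (s≤s z≤n) (≤-trans (n≤1+n _) (pair≤n i))))
                         (fromℕ< (col (suc (first i)) (s≤s z≤n) (pair≤n i)))
  collision : (∃₂ λ i j → toℕ i < toℕ j × colorPair i ≡ colorPair j) →
    ∃₂ λ p q → 1 ≤ p × suc p < q × suc q ≤ n × φ p ≡ φ q × φ (suc p) ≡ φ (suc q)
  collision (i , j , i<j , same) =
    first i , first j , s≤s z≤n , s≤s (≤-trans (≤-reflexive (sym (*-suc 2 (toℕ i)))) (*-monoʳ-≤ 2 i<j)) , pair≤n j ,
    fromℕ<-injective _ _ _ _ (proj₁ sameColors) , fromℕ<-injective _ _ _ _ (proj₂ sameColors)
    where sameColors = combine-injective {k} {k} _ _ _ _ same

repeatedPair-hyperedge : ∀ {n p q} → 1 ≤ p → suc p < q → suc q ≤ n → IsHyperedge n (twoI p (suc p) q (suc q))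
repeatedPair-hyperedge {n} {p} {q} 1≤p 1+p<q 1+q≤n =
  (1≤p , <⇒≤ (<-≤-trans 1+p<q (<⇒≤ 1+q≤n))) , (≤-trans 1≤p (<⇒≤ (<-trans (n<1+n p) 1+p<q)) , 1+q≤n) ,
  three-members⇒3≤count (inUnion e) 1≤p (n<1+n p) 1+p<q (<⇒≤ 1+q≤n)
    (inUnion⁺ˡ e ≤-refl (n≤1+n p)) (inUnion⁺ˡ e (n≤1+n p) ≤-refl) (inUnion⁺ʳ e ≤-refl (n≤1+n q))
  where e = twoI p (suc p) q (suc q)

lowerBound : ∀ {n k} → HasCFColoring n k → n ≤ suc (2 * (k * k))
lowerBound {n} {k} (φ , col , cf) = ≮⇒≥ λ 2k²+1<n →
  impossible (repeatedPair col (subst (_≤ n) (sym (*-suc 2 (k * k))) 2k²+1<n))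
  where
  impossible : ¬ (∃₂ λ p q → 1 ≤ p × suc p < q × suc q ≤ n × φ p ≡ φ q × φ (suc p) ≡ φ (suc q))
  impossible (p , q , 1≤p , 1+p<q , 1+q≤n , φp≡φq , φ1+p≡φ1+q) =
    noUniqueColor⇒¬conflictFreeOn {φ} {twoI p (suc p) q (suc q)} (repeatedPair-noUniqueColor φ 1+p<q φp≡φq φ1+p≡φ1+q)
      (cf _ (repeatedPair-hyperedge 1≤p 1+p<q 1+q≤n))

χ²-lowerBound : ∀ {n k} → 1 ≤ n → HasCFColoring n k → n ≤ 3 * (k * k)
χ²-lowerBound {n} {k} 1≤n h@(_ , col , _) = ≤-trans (lowerBound h) (+-monoˡ-≤ (2 * (k * k)) 1≤k²)
  where
  1≤k : 1 ≤ k
  1≤k = ≤-trans (s≤s z≤n) (col 1 ≤-refl 1≤n)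
  1≤k² : 1 ≤ k * k
  1≤k² = *-mono-≤ 1≤k 1≤k

-- Upper bound

parity-suc : ∀ n → parity (suc n) ≡ parity n ⁻¹
parity-suc n = sym (⁻¹-selfInverse (suc-homo-⁻¹ n))

consecutive-parities : ∀ l → ∃₂ λ e d → parity e ≡ 0ℙ × parity d ≡ 1ℙ × l ≤ e × e ≤ suc l × l ≤ d × d ≤ suc l
consecutive-parities l with parity l in eq
... | 0ℙ = l , suc l , eq , trans (parity-suc l) (cong _⁻¹ eq) , ≤-refl , n≤1+n l , n≤1+n l , ≤-refl
... | 1ℙ = suc l , l , trans (parity-suc l) (cong _⁻¹ eq) , eq , n≤1+n l , ≤-refl , ≤-refl , n≤1+n l

4+l≰2+l : ∀ l → 4 + l ≰ 2 + l
4+l≰2+l l (s≤s (s≤s 2+l≤l)) = 1+n≰n (≤-trans (n≤1+n (suc l)) 2+l≤l)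

-- The offsets of two intervals in blocks g < h, where odd colors are shared and even ones shift
-- by 4(h − g). An odd offset at the start of [l₂, r₂] lies in [l₁, r₁], so l₁ ≤ l₂ + 1, while an
-- even offset at the start of a non-singleton interval forces l₁ ≥ l₂ + 3.
crossedOffsets-impossible : ∀ {l₁ r₁ l₂ r₂} → l₁ < r₁ ⊎ l₂ < r₂ →
  (∀ {o} → l₁ ≤ o → o ≤ r₁ → parity o ≡ 1ℙ → l₂ ≤ o × o ≤ r₂) →
  (∀ {o} → l₂ ≤ o → o ≤ r₂ → parity o ≡ 1ℙ → l₁ ≤ o × o ≤ r₁) →
  (∀ {o} → l₁ ≤ o → o ≤ r₁ → parity o ≡ 0ℙ → 4 + l₂ ≤ o) →
  (∀ {o} → l₂ ≤ o → o ≤ r₂ → parity o ≡ 0ℙ → 4 + o ≤ r₁) → ⊥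
crossedOffsets-impossible {l₁} {r₁} {l₂} {r₂} _ odd₁ odd₂ even₁ even₂ with l₁ <? r₁
... | yes l₁<r₁ with consecutive-parities l₁ | consecutive-parities l₂
...   | e , d , pe , pd , l₁≤e , e≤1+l₁ , l₁≤d , d≤1+l₁ | _ , d₂ , _ , pd₂ , _ , _ , l₂≤d₂ , d₂≤1+l₂ =
  4+l≰2+l l₂ (begin
    4 + l₂   ≤⟨ 4+l₂≤e ⟩
    e        ≤⟨ e≤1+l₁ ⟩
    suc l₁   ≤⟨ s≤s (proj₁ (odd₂ l₂≤d₂ d₂≤r₂ pd₂)) ⟩
    suc d₂   ≤⟨ s≤s d₂≤1+l₂ ⟩
    2 + l₂   ∎)
  where
  open ≤-Reasoning
  4+l₂≤e : 4 + l₂ ≤ e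
  4+l₂≤e = even₁ l₁≤e (≤-trans e≤1+l₁ l₁<r₁) pe
  d₂≤r₂ : d₂ ≤ r₂
  d₂≤r₂ = begin
    d₂       ≤⟨ d₂≤1+l₂ ⟩
    suc l₂   ≤⟨ ≤-trans (n≤1+n _) (n≤1+n _) ⟩
    3 + l₂   ≤⟨ ≤-pred (≤-trans 4+l₂≤e e≤1+l₁) ⟩
    l₁       ≤⟨ l₁≤d ⟩
    d        ≤⟨ proj₂ (odd₁ l₁≤d (≤-trans d≤1+l₁ l₁<r₁) pd) ⟩
    r₂       ∎
crossedOffsets-impossible (inj₁ l₁<r₁) _ _ _ _ | no l₁≮r₁ = contradiction l₁<r₁ l₁≮r₁
crossedOffsets-impossible {l₁} {r₁} {l₂} (inj₂ l₂<r₂) _ odd₂ _ even₂ | no l₁≮r₁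
  with consecutive-parities l₂
... | e₂ , d₂ , pe₂ , pd₂ , l₂≤e₂ , e₂≤1+l₂ , l₂≤d₂ , d₂≤1+l₂ =
  4+l≰2+l l₂ (begin
    4 + l₂   ≤⟨ +-monoʳ-≤ 4 l₂≤e₂ ⟩
    4 + e₂   ≤⟨ even₂ l₂≤e₂ (≤-trans e₂≤1+l₂ l₂<r₂) pe₂ ⟩
    r₁       ≤⟨ ≮⇒≥ l₁≮r₁ ⟩
    l₁       ≤⟨ proj₁ (odd₂ l₂≤d₂ (≤-trans d₂≤1+l₂ l₂<r₂) pd₂) ⟩
    d₂       ≤⟨ d₂≤1+l₂ ⟩
    suc l₂   ≤⟨ n≤1+n _ ⟩
    2 + l₂   ∎)
  where open ≤-Reasoning

4h+o′≡4g+o⇒4+o′≤o : ∀ {g h o o′} → g < h → 4 * h + o′ ≡ 4 * g + o → 4 + o′ ≤ o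
4h+o′≡4g+o⇒4+o′≤o {g} {h} {o} {o′} g<h eq = +-cancelˡ-≤ (4 * g) (4 + o′) o (begin
  4 * g + (4 + o′)  ≡⟨ solve (g ∷ o′ ∷ []) ⟩
  4 * suc g + o′    ≤⟨ +-monoˡ-≤ o′ (*-monoʳ-≤ 4 g<h) ⟩
  4 * h + o′        ≡⟨ eq ⟩
  4 * g + o         ∎)
  where open ≤-Reasoning

¬increasingTriple-inPair : ∀ {x y z p q : ℕ} → x < y → y < z →
  x ≡ p ⊎ x ≡ q → y ≡ p ⊎ y ≡ q → z ≡ p ⊎ z ≡ q → ⊥
¬increasingTriple-inPair x<y y<z (inj₁ refl) (inj₁ refl) _ = <-irrefl refl x<y
¬increasingTriple-inPair x<y y<z (inj₂ refl) (inj₂ refl) _ = <-irrefl refl x<y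
¬increasingTriple-inPair x<y y<z _ (inj₁ refl) (inj₁ refl) = <-irrefl refl y<z
¬increasingTriple-inPair x<y y<z _ (inj₂ refl) (inj₂ refl) = <-irrefl refl y<z
¬increasingTriple-inPair x<y y<z (inj₁ refl) (inj₂ refl) (inj₁ refl) = <-irrefl refl (<-trans x<y y<z)
¬increasingTriple-inPair x<y y<z (inj₂ refl) (inj₁ refl) (inj₂ refl) = <-irrefl refl (<-trans x<y y<z)

module BlockColoring (s : ℕ) {{_ : NonZero s}} where

  vertex : ℕ → ℕ → ℕ
  vertex g o = suc (o + g * s)

  block offset : ℕ → ℕ
  block x = pred x / s
  offset x = pred x % s

  vertex-block-offset : ∀ {x} → 1 ≤ x → vertex (block x) (offset x) ≡ x
  vertex-block-offset {suc x} _ = cong suc (sym (m≡m%n+[m/n]*n x s))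

  offset<s : ∀ x → offset x < s
  offset<s x = m%n<n (pred x) s

  block-vertex : ∀ g {o} → o < s → block (vertex g o) ≡ g
  block-vertex g {o} o<s = begin
    (o + g * s) / s      ≡⟨ +-distrib-/-∣ʳ o (n∣m*n g) ⟩
    o / s + g * s / s    ≡⟨ cong₂ _+_ (m<n⇒m/n≡0 o<s) (m*n/n≡m g s) ⟩
    g                    ∎
    where open ≡-Reasoning

  offset-vertex : ∀ g {o} → o < s → offset (vertex g o) ≡ o
  offset-vertex g {o} o<s = trans ([m+kn]%n≡m%n o g s) (m<n⇒m%n≡m o<s)

  block-mono : ∀ {x y} → x ≤ y → block x ≤ block y
  block-mono x≤y = /-monoˡ-≤ s (pred-mono-≤ x≤y)

  block<s : ∀ {x} → 1 ≤ x → x ≤ s * s → block x < s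
  block<s {suc x} _ x<s² = m<n*o⇒m/o<n x<s²

  vertex-monoʳ-≤ : ∀ g {o o′} → o ≤ o′ → vertex g o ≤ vertex g o′
  vertex-monoʳ-≤ g o≤o′ = s≤s (+-monoˡ-≤ (g * s) o≤o′)

  vertex-cancelʳ-≤ : ∀ g {o o′} → vertex g o ≤ vertex g o′ → o ≤ o′
  vertex-cancelʳ-≤ g {o} {o′} (s≤s le) = +-cancelʳ-≤ (g * s) o o′ le

  vertex-<-nextBlock : ∀ {g h o} → o < s → g < h → vertex g o < vertex h 0
  vertex-<-nextBlock {g} {h} {o} o<s g<h = s≤s (begin
    suc (o + g * s)  ≤⟨ +-monoˡ-≤ (g * s) o<s ⟩
    s + g * s        ≤⟨ *-monoˡ-≤ s g<h ⟩
    h * s            ∎)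
    where open ≤-Reasoning

  vertex-injective : ∀ {x y} → 1 ≤ x → 1 ≤ y → block x ≡ block y → offset x ≡ offset y → x ≡ y
  vertex-injective {x} {y} 1≤x 1≤y bx≡by ox≡oy = begin
    x                            ≡⟨ vertex-block-offset 1≤x ⟨
    vertex (block x) (offset x)  ≡⟨ cong₂ vertex bx≡by ox≡oy ⟩
    vertex (block y) (offset y)  ≡⟨ vertex-block-offset 1≤y ⟩
    y                            ∎
    where open ≡-Reasoning

  offset-mono-inBlock : ∀ {x y} → 1 ≤ x → 1 ≤ y → block x ≡ block y → x ≤ y → offset x ≤ offset y
  offset-mono-inBlock {x} {y} 1≤x 1≤y bx≡by x≤y = vertex-cancelʳ-≤ (block x) (begin
    vertex (block x) (offset x)  ≡⟨ vertex-block-offset 1≤x ⟩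
    x                            ≤⟨ x≤y ⟩
    y                            ≡⟨ vertex-block-offset 1≤y ⟨
    vertex (block y) (offset y)  ≡⟨ cong (λ g → vertex g (offset y)) bx≡by ⟨
    vertex (block x) (offset y)  ∎)
    where open ≤-Reasoning

  inBlockInterval⁻ : ∀ {a b y} → 1 ≤ a → block a ≡ block b → a ≤ y → y ≤ b →
    block y ≡ block a × offset a ≤ offset y × offset y ≤ offset b
  inBlockInterval⁻ {a} {b} {y} 1≤a ba≡bb a≤y y≤b =
    by≡ba , offset-mono-inBlock 1≤a 1≤y (sym by≡ba) a≤y , offset-mono-inBlock 1≤y (≤-trans 1≤y y≤b) (trans by≡ba ba≡bb) y≤b
    where
    1≤y : 1 ≤ y
    1≤y = ≤-trans 1≤a a≤y
    by≡ba : block y ≡ block a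
    by≡ba = ≤-antisym (subst (block y ≤_) (sym ba≡bb) (block-mono y≤b)) (block-mono a≤y)

  inBlockInterval⁺ : ∀ {a b o} → 1 ≤ a → 1 ≤ b → block a ≡ block b → offset a ≤ o → o ≤ offset b →
    a ≤ vertex (block a) o × vertex (block a) o ≤ b
  inBlockInterval⁺ {a} {b} {o} 1≤a 1≤b ba≡bb oa≤o o≤ob =
    subst (_≤ vertex (block a) o) (vertex-block-offset 1≤a) (vertex-monoʳ-≤ (block a) oa≤o) ,
    subst (vertex (block a) o ≤_) (trans (cong (λ g → vertex g (offset b)) ba≡bb) (vertex-block-offset 1≤b))
      (vertex-monoʳ-≤ (block a) o≤ob)

  offset-strictMono-inBlock : ∀ {x y} → 1 ≤ x → block x ≡ block y → x < y → offset x < offset y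
  offset-strictMono-inBlock 1≤x bx≡by x<y = ≤∧≢⇒<
    (offset-mono-inBlock 1≤x 1≤y bx≡by (<⇒≤ x<y))
    (λ ox≡oy → <⇒≢ x<y (vertex-injective 1≤x 1≤y bx≡by ox≡oy))
    where 1≤y = ≤-trans 1≤x (<⇒≤ x<y)

  -- Colors [s, 2s) go to odd offsets, shared by all blocks; colors [2s, 7s) to even offsets,
  -- shifted by 4 from one block to the next.
  nonMarkerColor : ℕ → ℕ → ℕ
  nonMarkerColor g o = byParity (parity o)
    where
    byParity : Parity → ℕ
    byParity 1ℙ = s + o
    byParity 0ℙ = s + s + 4 * g + o

  -- Offset 0 marks the start of block g, which is the only vertex colored g.
  color : ℕ → ℕ → ℕ
  color g zero = g
  color g o@(suc _) = nonMarkerColor g o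

  blockColoring : ℕ → ℕ
  blockColoring x = color (block x) (offset x)

  s≤nonMarkerColor : ∀ g o → s ≤ nonMarkerColor g o
  s≤nonMarkerColor g o with parity o
  ... | 1ℙ = m≤m+n s o
  ... | 0ℙ = ≤-trans (m≤m+n s s) (≤-trans (m≤m+n _ (4 * g)) (m≤m+n _ o))

  nonMarkerColor<7s : ∀ {g o} → g < s → o < s → nonMarkerColor g o < 7 * s
  nonMarkerColor<7s {g} {o} g<s o<s with parity o
  ... | 1ℙ = begin-strict
    s + o                <⟨ +-monoʳ-< s o<s ⟩
    s + s                ≤⟨ +-monoʳ-≤ s (m≤m+n s _) ⟩
    7 * s                ∎
    where open ≤-Reasoning
  ... | 0ℙ = begin-strict
    s + s + 4 * g + o    <⟨ +-monoʳ-< (s + s + 4 * g) o<s ⟩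
    s + s + 4 * g + s    ≤⟨ +-monoˡ-≤ s (+-monoʳ-≤ (s + s) (*-monoʳ-≤ 4 (<⇒≤ g<s))) ⟩
    s + s + 4 * s + s    ≡⟨ solve (s ∷ []) ⟩
    7 * s                ∎
    where open ≤-Reasoning

  odd≢even : ∀ {g o o′} → o < s → s + o ≢ s + s + 4 * g + o′
  odd≢even {g} {o} {o′} o<s = <⇒≢ (≤-trans (+-monoʳ-< s o<s) (≤-trans (m≤m+n (s + s) (4 * g)) (m≤m+n _ o′)))

  nonMarkerColor-≡ : ∀ {g h o o′} → o < s → o′ < s → nonMarkerColor h o′ ≡ nonMarkerColor g o →
    (parity o ≡ 1ℙ × o′ ≡ o) ⊎ (parity o ≡ 0ℙ × 4 * h + o′ ≡ 4 * g + o)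
  nonMarkerColor-≡ {g} {h} {o} {o′} o<s o′<s eq with parity o | parity o′
  ... | 1ℙ | 1ℙ = inj₁ (refl , +-cancelˡ-≡ s o′ o eq)
  ... | 1ℙ | 0ℙ = contradiction (sym eq) (odd≢even {h} o<s)
  ... | 0ℙ | 1ℙ = contradiction eq (odd≢even {g} o′<s)
  ... | 0ℙ | 0ℙ = inj₂ (refl , +-cancelˡ-≡ (s + s) _ _
    (trans (sym (+-assoc (s + s) (4 * h) o′)) (trans eq (+-assoc (s + s) (4 * g) o))))

  nonMarkerColor-≡-odd : ∀ {g h o o′} → o < s → o′ < s → parity o ≡ 1ℙ →
    nonMarkerColor h o′ ≡ nonMarkerColor g o → o′ ≡ o
  nonMarkerColor-≡-odd o<s o′<s po eq with nonMarkerColor-≡ o<s o′<s eq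
  ... | inj₁ (_ , o′≡o) = o′≡o
  ... | inj₂ (po′ , _) = contradiction (trans (sym po) po′) λ ()

  nonMarkerColor-≡-even : ∀ {g h o o′} → o < s → o′ < s → parity o ≡ 0ℙ →
    nonMarkerColor h o′ ≡ nonMarkerColor g o → 4 * h + o′ ≡ 4 * g + o
  nonMarkerColor-≡-even o<s o′<s po eq with nonMarkerColor-≡ o<s o′<s eq
  ... | inj₁ (po′ , _) = contradiction (trans (sym po) po′) λ ()
  ... | inj₂ (_ , shifted) = shifted

  color-nonMarker : ∀ g {o} → o ≢ 0 → color g o ≡ nonMarkerColor g o
  color-nonMarker g {zero} o≢0 = contradiction refl o≢0
  color-nonMarker g {suc o} _ = refl

  color<7s : ∀ {g o} → g < s → o < s → color g o < 7 * s
  color<7s {o = zero} g<s _ = ≤-trans g<s (m≤n*m s 7)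
  color<7s {o = suc o} g<s o<s = nonMarkerColor<7s g<s o<s

  color-marker : ∀ {g h o} → g < s → color h o ≡ color g 0 → o ≡ 0 × h ≡ g
  color-marker {o = zero} _ h≡g = refl , h≡g
  color-marker {g} {h} {suc o} g<s eq = contradiction (≤-trans (s≤nonMarkerColor h (suc o)) (≤-reflexive eq)) (<⇒≱ g<s)

  color-injectiveʳ : ∀ {g o o′} → g < s → o < s → o′ < s → color g o ≡ color g o′ → o ≡ o′
  color-injectiveʳ {o = zero} {zero} _ _ _ _ = refl
  color-injectiveʳ {g} {zero} {suc o′} g<s _ _ eq = sym (proj₁ (color-marker {g} {g} {suc o′} g<s (sym eq)))
  color-injectiveʳ {o = suc _} {zero} g<s _ _ eq = proj₁ (color-marker g<s eq)
  color-injectiveʳ {g} {suc o} {suc o′} _ o<s o′<s eq with nonMarkerColor-≡ o′<s o<s eq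
  ... | inj₁ (_ , o≡o′) = o≡o′
  ... | inj₂ (_ , eq′) = +-cancelˡ-≡ (4 * g) _ _ eq′

  blockColoring-isColoring : ∀ {n} → n ≤ s * s → IsColoring n (7 * s) blockColoring
  blockColoring-isColoring n≤s² x 1≤x x≤n = color<7s (block<s 1≤x (≤-trans x≤n n≤s²)) (offset<s x)

  marker-uniqueColor : ∀ {x y} → 1 ≤ x → x ≤ s * s → 1 ≤ y → offset x ≡ 0 →
    blockColoring y ≡ blockColoring x → y ≡ x
  marker-uniqueColor {x} {y} 1≤x x≤s² 1≤y ox≡0 eq
    with color-marker (block<s 1≤x x≤s²) (subst (λ o → blockColoring y ≡ color (block x) o) ox≡0 eq)
  ... | oy≡0 , by≡bx = vertex-injective 1≤y 1≤x by≡bx (trans oy≡0 (sym ox≡0))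

  blockColoring-injective-inBlock : ∀ {x y} → 1 ≤ x → x ≤ s * s → 1 ≤ y → block y ≡ block x →
    blockColoring y ≡ blockColoring x → y ≡ x
  blockColoring-injective-inBlock {x} {y} 1≤x x≤s² 1≤y by≡bx eq = vertex-injective 1≤y 1≤x by≡bx
    (color-injectiveʳ (block<s 1≤x x≤s²) (offset<s y) (offset<s x)
      (subst (λ g → color g (offset y) ≡ blockColoring x) by≡bx eq))

  module _ {n e} (n≤s² : n ≤ s * s) (he : IsHyperedge n e) (twin : NoUniqueColor blockColoring e) where

    Member : ℕ → Set
    Member x = T (inUnion e x)

    Interval⊆e : ℕ → ℕ → Set
    Interval⊆e a b = ∀ {x} → a ≤ x → x ≤ b → Member x

    1≤member : ∀ {x} → Member x → 1 ≤ x
    1≤member = proj₁ ∘ hyperedge⊆[1,n] e he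

    member≤s² : ∀ {x} → Member x → x ≤ s * s
    member≤s² x∈e = ≤-trans (proj₂ (hyperedge⊆[1,n] e he x∈e)) n≤s²

    member-nonMarker : ∀ {x} → Member x → offset x ≢ 0
    member-nonMarker x∈e ox≡0 with twin x∈e
    ... | y , y∈e , y≢x , φy≡φx = y≢x (marker-uniqueColor (1≤member x∈e) (member≤s² x∈e) (1≤member y∈e) ox≡0 φy≡φx)

    sameColor-otherBlock : ∀ {x y} → Member x → Member y → y ≢ x → blockColoring y ≡ blockColoring x → block y ≢ block x
    sameColor-otherBlock x∈e y∈e y≢x φy≡φx by≡bx =
      y≢x (blockColoring-injective-inBlock (1≤member x∈e) (member≤s² x∈e) (1≤member y∈e) by≡bx φy≡φx)

    oneBlock-impossible : ∀ {g x} → Member x → (∀ {y} → Member y → block y ≡ g) → ⊥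
    oneBlock-impossible x∈e inBlock with twin x∈e
    ... | y , y∈e , y≢x , φy≡φx = sameColor-otherBlock x∈e y∈e y≢x φy≡φx (trans (inBlock y∈e) (sym (inBlock x∈e)))

    interval-inOneBlock : ∀ {a b} → 1 ≤ a → a ≤ b → Interval⊆e a b → block a ≡ block b
    interval-inOneBlock {a} {b} 1≤a a≤b ⊆e with m≤n⇒m<n∨m≡n (block-mono a≤b)
    ... | inj₂ ba≡bb = ba≡bb
    ... | inj₁ ba<bb = contradiction (offset-vertex (block b) (>-nonZero⁻¹ s)) (member-nonMarker (⊆e a≤m m≤b))
      where
      m = vertex (block b) 0
      a≤m : a ≤ m
      a≤m = subst (_≤ m) (vertex-block-offset 1≤a) (<⇒≤ (vertex-<-nextBlock (offset<s a) ba<bb))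
      m≤b : m ≤ b
      m≤b = subst (m ≤_) (vertex-block-offset (≤-trans 1≤a a≤b)) (vertex-monoʳ-≤ (block b) z≤n)

    -- The twin lies outside [a, b] because colors within a block are distinct.
    twinOffset : ∀ {a b c d} → 1 ≤ a → a ≤ b → block a ≡ block b → 1 ≤ c → block c ≡ block d → Interval⊆e a b →
      (∀ {x} → Member x → (a ≤ x × x ≤ b) ⊎ (c ≤ x × x ≤ d)) →
      ∀ {o} → offset a ≤ o → o ≤ offset b →
      ∃ λ o′ → offset c ≤ o′ × o′ ≤ offset d × nonMarkerColor (block c) o′ ≡ nonMarkerColor (block a) o
    twinOffset {a} {b} {c} {d} 1≤a a≤b ba≡bb 1≤c bc≡bd [a,b]⊆e e⊆ {o} oa≤o o≤ob = fromTwin (twin x∈e)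
      where
      o<s : o < s
      o<s = ≤-<-trans o≤ob (offset<s b)
      x = vertex (block a) o
      x∈e : Member x
      x∈e = let (a≤x , x≤b) = inBlockInterval⁺ 1≤a (≤-trans 1≤a a≤b) ba≡bb oa≤o o≤ob in [a,b]⊆e a≤x x≤b
      fromTwin : (∃ λ y → Member y × y ≢ x × blockColoring y ≡ blockColoring x) →
        ∃ λ o′ → offset c ≤ o′ × o′ ≤ offset d × nonMarkerColor (block c) o′ ≡ nonMarkerColor (block a) o
      fromTwin (y , y∈e , y≢x , φy≡φx) with e⊆ y∈e
      ... | inj₁ (a≤y , y≤b) = contradiction
        (trans (proj₁ (inBlockInterval⁻ 1≤a ba≡bb a≤y y≤b)) (sym (block-vertex (block a) o<s)))
        (sameColor-otherBlock x∈e y∈e y≢x φy≡φx)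
      ... | inj₂ (c≤y , y≤d) with inBlockInterval⁻ 1≤c bc≡bd c≤y y≤d
      ...   | by≡bc , oc≤oy , oy≤od = offset y , oc≤oy , oy≤od , (begin
        nonMarkerColor (block c) (offset y)  ≡⟨ cong (λ g → nonMarkerColor g (offset y)) by≡bc ⟨
        nonMarkerColor (block y) (offset y)  ≡⟨ color-nonMarker (block y) (member-nonMarker y∈e) ⟨
        blockColoring y                      ≡⟨ φy≡φx ⟩
        blockColoring x                      ≡⟨ color-nonMarker (block x) (member-nonMarker x∈e) ⟩
        nonMarkerColor (block x) (offset x)
          ≡⟨ cong₂ nonMarkerColor (block-vertex (block a) o<s) (offset-vertex (block a) o<s) ⟩
        nonMarkerColor (block a) o           ∎)
        where open ≡-Reasoning

    crossedIntervals-impossible : ∀ {a b c d} → 1 ≤ a → a ≤ b → 1 ≤ c → c ≤ d → Interval⊆e a b → Interval⊆e c d →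
      (∀ {x} → Member x → (a ≤ x × x ≤ b) ⊎ (c ≤ x × x ≤ d)) → block a < block c → a < b ⊎ c < d → ⊥
    crossedIntervals-impossible {a} {b} {c} {d} 1≤a a≤b 1≤c c≤d [a,b]⊆e [c,d]⊆e e⊆ ba<bc nonSingleton =
      crossedOffsets-impossible offsetsNonSingleton odd₁ odd₂ even₁ even₂
      where
      ba≡bb = interval-inOneBlock 1≤a a≤b [a,b]⊆e
      bc≡bd = interval-inOneBlock 1≤c c≤d [c,d]⊆e
      forward = twinOffset 1≤a a≤b ba≡bb 1≤c bc≡bd [a,b]⊆e e⊆
      backward = twinOffset 1≤c c≤d bc≡bd 1≤a ba≡bb [c,d]⊆e (swap ∘ e⊆)
      offsetsNonSingleton : offset a < offset b ⊎ offset c < offset d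
      offsetsNonSingleton = Sum.map (offset-strictMono-inBlock 1≤a ba≡bb) (offset-strictMono-inBlock 1≤c bc≡bd) nonSingleton
      odd₁ : ∀ {o} → offset a ≤ o → o ≤ offset b → parity o ≡ 1ℙ → offset c ≤ o × o ≤ offset d
      odd₁ oa≤o o≤ob po with forward oa≤o o≤ob
      ... | o′ , oc≤o′ , o′≤od , eq = subst (λ z → offset c ≤ z × z ≤ offset d)
        (nonMarkerColor-≡-odd (≤-<-trans o≤ob (offset<s b)) (≤-<-trans o′≤od (offset<s d)) po eq) (oc≤o′ , o′≤od)
      odd₂ : ∀ {o} → offset c ≤ o → o ≤ offset d → parity o ≡ 1ℙ → offset a ≤ o × o ≤ offset b
      odd₂ oc≤o o≤od po with backward oc≤o o≤od
      ... | o′ , oa≤o′ , o′≤ob , eq = subst (λ z → offset a ≤ z × z ≤ offset b)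
        (nonMarkerColor-≡-odd (≤-<-trans o≤od (offset<s d)) (≤-<-trans o′≤ob (offset<s b)) po eq) (oa≤o′ , o′≤ob)
      even₁ : ∀ {o} → offset a ≤ o → o ≤ offset b → parity o ≡ 0ℙ → 4 + offset c ≤ o
      even₁ oa≤o o≤ob po with forward oa≤o o≤ob
      ... | o′ , oc≤o′ , o′≤od , eq = ≤-trans (+-monoʳ-≤ 4 oc≤o′) (4h+o′≡4g+o⇒4+o′≤o ba<bc
        (nonMarkerColor-≡-even (≤-<-trans o≤ob (offset<s b)) (≤-<-trans o′≤od (offset<s d)) po eq))
      even₂ : ∀ {o} → offset c ≤ o → o ≤ offset d → parity o ≡ 0ℙ → 4 + o ≤ offset b
      even₂ oc≤o o≤od po with backward oc≤o o≤od
      ... | o′ , oa≤o′ , o′≤ob , eq = ≤-trans (4h+o′≡4g+o⇒4+o′≤o ba<bc (sym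
        (nonMarkerColor-≡-even (≤-<-trans o≤od (offset<s d)) (≤-<-trans o′≤ob (offset<s b)) po eq))) o′≤ob

    inOneBlock : ∀ {a b y} → 1 ≤ a → a ≤ b → Interval⊆e a b → a ≤ y → y ≤ b → block y ≡ block a
    inOneBlock 1≤a a≤b ⊆e a≤y y≤b = proj₁ (inBlockInterval⁻ 1≤a (interval-inOneBlock 1≤a a≤b ⊆e) a≤y y≤b)

    nonSingleton : ∀ {x y z} → x < y → y < z → Member x → Member y → Member z → a₁ e < b₁ e ⊎ a₂ e < b₂ e
    nonSingleton x<y y<z x∈e y∈e z∈e with a₁ e <? b₁ e | a₂ e <? b₂ e
    ... | yes a₁<b₁ | _ = inj₁ a₁<b₁
    ... | no _ | yes a₂<b₂ = inj₂ a₂<b₂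
    ... | no a₁≮b₁ | no a₂≮b₂ = ⊥-elim (¬increasingTriple-inPair x<y y<z (endpoint x∈e) (endpoint y∈e) (endpoint z∈e))
      where
      endpoint : ∀ {x} → Member x → x ≡ a₁ e ⊎ x ≡ a₂ e
      endpoint x∈e with inUnion⁻ e x∈e
      ... | inj₁ (a₁≤x , x≤b₁) = inj₁ (≤-antisym (≤-trans x≤b₁ (≮⇒≥ a₁≮b₁)) a₁≤x)
      ... | inj₂ (a₂≤x , x≤b₂) = inj₂ (≤-antisym (≤-trans x≤b₂ (≮⇒≥ a₂≮b₂)) a₂≤x)

    emptyInterval : ∀ {a b x} → ¬ a ≤ b → a ≤ x → x ≤ b → ⊥
    emptyInterval a≰b a≤x x≤b = a≰b (≤-trans a≤x x≤b)

    1≤a₁ : 1 ≤ a₁ e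
    1≤a₁ = proj₁ (proj₁ he)

    1≤a₂ : 1 ≤ a₂ e
    1≤a₂ = proj₁ (proj₁ (proj₂ he))

    noUniqueColor-impossible : ⊥
    noUniqueColor-impossible with 3≤count⇒three-members (inUnion e) n (proj₂ (proj₂ he))
    ... | x , y , z , x<y , y<z , x∈e , y∈e , z∈e with a₁ e ≤? b₁ e | a₂ e ≤? b₂ e
    ...   | no a₁≰b₁ | no a₂≰b₂ = [ uncurry (emptyInterval a₁≰b₁) , uncurry (emptyInterval a₂≰b₂) ] (inUnion⁻ e x∈e)
    ...   | yes a₁≤b₁ | no a₂≰b₂ = oneBlock-impossible x∈e λ y∈e →
      [ uncurry (inOneBlock 1≤a₁ a₁≤b₁ (inUnion⁺ˡ e)) , ⊥-elim ∘ uncurry (emptyInterval a₂≰b₂) ] (inUnion⁻ e y∈e)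
    ...   | no a₁≰b₁ | yes a₂≤b₂ = oneBlock-impossible x∈e λ y∈e →
      [ ⊥-elim ∘ uncurry (emptyInterval a₁≰b₁) , uncurry (inOneBlock 1≤a₂ a₂≤b₂ (inUnion⁺ʳ e)) ] (inUnion⁻ e y∈e)
    ...   | yes a₁≤b₁ | yes a₂≤b₂ with <-cmp (block (a₁ e)) (block (a₂ e))
    ...     | tri< b₁<b₂ _ _ = crossedIntervals-impossible 1≤a₁ a₁≤b₁ 1≤a₂ a₂≤b₂ (inUnion⁺ˡ e) (inUnion⁺ʳ e)
      (inUnion⁻ e) b₁<b₂ (nonSingleton x<y y<z x∈e y∈e z∈e)
    ...     | tri> _ _ b₂<b₁ = crossedIntervals-impossible 1≤a₂ a₂≤b₂ 1≤a₁ a₁≤b₁ (inUnion⁺ʳ e) (inUnion⁺ˡ e)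
      (swap ∘ inUnion⁻ e) b₂<b₁ (swap (nonSingleton x<y y<z x∈e y∈e z∈e))
    ...     | tri≈ _ b₁≡b₂ _ = oneBlock-impossible x∈e λ y∈e →
      [ uncurry (inOneBlock 1≤a₁ a₁≤b₁ (inUnion⁺ˡ e)) ,
        (λ y∈I₂ → trans (uncurry (inOneBlock 1≤a₂ a₂≤b₂ (inUnion⁺ʳ e)) y∈I₂) (sym b₁≡b₂)) ] (inUnion⁻ e y∈e)

  blockColoring-conflictFree : ∀ {n} → n ≤ s * s → ConflictFree n blockColoring
  blockColoring-conflictFree {n} n≤s² e he = decidable-stable (conflictFreeOn? n blockColoring e bounded)
    (noUniqueColor-impossible n≤s² he ∘ ¬conflictFreeOn⇒noUniqueColor n blockColoring e bounded)
    where
    bounded : ∀ {x} → T (inUnion e x) → x ≤ n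
    bounded = proj₂ ∘ hyperedge⊆[1,n] e he

  upperBound : ∀ {n} → n ≤ s * s → HasCFColoring n (7 * s)
  upperBound n≤s² = blockColoring , blockColoring-isColoring n≤s² , blockColoring-conflictFree n≤s²

squareBetween-n-4n : ∀ {n} → 1 ≤ n → ∃ λ r → n ≤ suc r * suc r × suc r * suc r ≤ 4 * n
squareBetween-n-4n {suc n} _ with least-satisfying (λ k → suc n ≤? k * k) (suc n) (m≤m*n (suc n) (suc n))
... | zero , () , _
... | suc zero , n≤1 , _ = 0 , n≤1 , s≤s z≤n
... | suc (suc r) , n≤[2+r]² , least = suc r , n≤[2+r]² , (begin
  (2 + r) * (2 + r)            ≤⟨ *-mono-≤ 2+r≤2+2r 2+r≤2+2r ⟩
  (2 + 2 * r) * (2 + 2 * r)    ≡⟨ solve (r ∷ []) ⟩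
  4 * ((1 + r) * (1 + r))      ≤⟨ *-monoʳ-≤ 4 (<⇒≤ [1+r]²<n) ⟩
  4 * suc n                    ∎)
  where
  open ≤-Reasoning
  2+r≤2+2r : 2 + r ≤ 2 + 2 * r
  2+r≤2+2r = +-monoʳ-≤ 2 (m≤m+n r (r + 0))
  [1+r]²<n : (1 + r) * (1 + r) < suc n
  [1+r]²<n = ≰⇒> (λ n≤[1+r]² → 1+n≰n (least (suc r) n≤[1+r]²))

χ²-upperBound : ∀ {n r χ} → IsChiCF n χ → n ≤ suc r * suc r → suc r * suc r ≤ 4 * n → χ * χ ≤ 196 * n
χ²-upperBound {n} {r} {χ} (_ , least) n≤[1+r]² [1+r]²≤4n = begin
  χ * χ                        ≤⟨ *-mono-≤ χ≤7[1+r] χ≤7[1+r] ⟩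
  (7 * suc r) * (7 * suc r)    ≡⟨ solve (r ∷ []) ⟩
  49 * (suc r * suc r)         ≤⟨ *-monoʳ-≤ 49 [1+r]²≤4n ⟩
  49 * (4 * n)                 ≡⟨ *-assoc 49 4 n ⟨
  196 * n                      ∎
  where
  open ≤-Reasoning
  χ≤7[1+r] : χ ≤ 7 * suc r
  χ≤7[1+r] = least (7 * suc r) (BlockColoring.upperBound (suc r) n≤[1+r]²)

theorem1p7 : Σ ℕ λ a → Σ ℕ λ b → Σ ℕ λ N →
    ∀ n → n ≥ N → Σ ℕ λ χ → IsChiCF n χ × (n ≤ a * (χ * χ)) × (χ * χ ≤ b * n)
theorem1p7 = 3 , 196 , 1 , λ n 1≤n →
  let (r , n≤[1+r]² , [1+r]²≤4n) = squareBetween-n-4n 1≤n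
      (χ , isχ) = chiCF-exists n (7 * suc r) (BlockColoring.upperBound (suc r) n≤[1+r]²)
  in χ , isχ , χ²-lowerBound 1≤n (proj₁ isχ) , χ²-upperBound {r = r} isχ n≤[1+r]² [1+r]²≤4n
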